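{- Let $\varphi(\mathbf{x},\mathbf{y})$ be a propagation complete encoding of $\mathrm{AMO}_n$ or of $\mathrm{EO}_n$. Then $\varphi$ is a P-encoding.
   Context: A CNF formula is a conjunction of clauses (disjunctions of literals with no complementary pair). Unit resolution: from a unit clause $l$ and a clause containing $\neg l$ derive the clause with $\neg l$ removed; $\varphi\wedge g_1\wedge\dots\wedge g_p\vdash_1 C$ means $C$ is derivable from $\varphi$ and the unit clauses $g_i$ by a sequence of unit resolutions, $\vdash_1\bot$ means the empty clause is derivable. $\mathrm{AMO}_n(x_1,\dots,x_n)=1$ iff at most one $x_i$ is $1$; $\mathrm{EO}_n(x_1,\dots,x_n)=1$ iff exactly one $x_i$ is $1$. A CNF $\varphi(\mathbf{x},\mathbf{y})$ with input variables $\mathbf{x}=(x_1,\dots,x_n)$ and auxiliary variables $\mathbf{y}=(y_1,\dots,y_\ell)$ is an encoding of $f(\mathbf{x})$ if for all $\alpha\in\{0,1\}^n$: $f(\alpha)=1$ iff $\exists\beta\in\{0,1\}^\ell$, $\varphi(\alpha,\beta)=1$; it is a propagation complete encoding if moreover for all literals $g_1,\dots,g_p$ ($p\ge1$) and $h$ on input variables with $f\wedge\bigwedge_i g_i\models h$, we have $\varphi\wedge\bigwedge_i g_i\vdash_1 h$ or $\varphi\wedge\bigwedge_i g_i\vdash_1\bot$. $\varphi(\mathbf{x},\mathbf{y})$ is a P-encoding if (P1) $\varphi\wedge x_i$ is satisfiable for each $i$ and (P2) $\varphi\wedge x_i\vdash_1\neg x_j$ for all $i\ne j$. -}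

module Defs where

open import Data.Nat using (ℕ; zero; suc; _+_; _≤ᵇ_; _≡ᵇ_)
open import Data.Bool using (Bool; true; false; not; if_then_else_)
import Data.Bool.Properties as BoolP
open import Data.Fin using (Fin)
import Data.Fin.Properties as FinP
open import Data.Sum using (_⊎_; inj₁; inj₂)
import Data.Sum.Properties as SumP
open import Data.Product using (Σ; _×_; _,_; ∃; ∃-syntax)
import Data.Product.Properties as ProdP
open import Data.List using (List; []; _∷_; filter)
open import Data.List.Membership.Propositional using (_∈_)
open import Data.List.Relation.Binary.Subset.Propositional using (_⊆_)
open import Data.List.Relation.Unary.All using (All)
open import Data.List.Relation.Unary.Any using (Any)
open import Relation.Nullary using (¬_; Dec)
open import Relation.Nullary.Decidable using (¬?)
open import Relation.Binary.PropositionalEquality using (_≡_; _≢_)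
open import Function.Bundles using (_⇔_)

-- Variables, literals, clauses, CNF formulas
-- Variables of φ(x,y): inj₁ i is the input variable x_i (i : Fin n),
-- inj₂ j is the auxiliary variable y_j (j : Fin ℓ).

Var : ℕ → ℕ → Set
Var n ℓ = Fin n ⊎ Fin ℓ

-- A literal is a variable with a polarity (true = positive literal v,
-- false = negative literal ¬v).
Literal : ℕ → ℕ → Set
Literal n ℓ = Var n ℓ × Bool

neg : ∀ {n ℓ} → Literal n ℓ → Literal n ℓ
neg (v , s) = (v , not s)

pos-x : ∀ {n ℓ} → Fin n → Literal n ℓ
pos-x i = (inj₁ i , true)

neg-x : ∀ {n ℓ} → Fin n → Literal n ℓ
neg-x i = (inj₁ i , false)

IsInputLit : ∀ {n ℓ} → Literal n ℓ → Set
IsInputLit {n} (v , _) = Σ (Fin n) λ i → v ≡ inj₁ i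

_≟L_ : ∀ {n ℓ} (a b : Literal n ℓ) → Dec (a ≡ b)
_≟L_ = ProdP.≡-dec (SumP.≡-dec FinP._≟_ FinP._≟_) BoolP._≟_

Clause : ℕ → ℕ → Set
Clause n ℓ = List (Literal n ℓ)

CNF : ℕ → ℕ → Set
CNF n ℓ = List (Clause n ℓ)

WellFormedCNF : ∀ {n ℓ} → CNF n ℓ → Set
WellFormedCNF φ = All (λ C → ∀ l → l ∈ C → ¬ (neg l ∈ C)) φ

_≈C_ : ∀ {n ℓ} → Clause n ℓ → Clause n ℓ → Set
C ≈C D = (C ⊆ D) × (D ⊆ C)

evalLit : ∀ {n ℓ} → (Fin n → Bool) → (Fin ℓ → Bool) → Literal n ℓ → Bool
evalLit α β (inj₁ i , s) = if s then α i else not (α i)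
evalLit α β (inj₂ j , s) = if s then β j else not (β j)

SatClause : ∀ {n ℓ} → (Fin n → Bool) → (Fin ℓ → Bool) → Clause n ℓ → Set
SatClause α β C = Any (λ l → evalLit α β l ≡ true) C

Sat : ∀ {n ℓ} → CNF n ℓ → (Fin n → Bool) → (Fin ℓ → Bool) → Set
Sat φ α β = All (SatClause α β) φ

remove : ∀ {n ℓ} → Literal n ℓ → Clause n ℓ → Clause n ℓ
remove l C = filter (λ m → ¬? (m ≟L l)) C

data UR {n ℓ} (φ : CNF n ℓ) (gs : List (Literal n ℓ)) : Clause n ℓ → Set where
  axiom : ∀ {C} → C ∈ φ → UR φ gs C
  unit  : ∀ {g} → g ∈ gs → UR φ gs (g ∷ [])
  resolve : ∀ {l C} → UR φ gs (l ∷ []) → UR φ gs C → neg l ∈ C →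
            UR φ gs (remove (neg l) C)

_∧_⊢₁_ : ∀ {n ℓ} → CNF n ℓ → List (Literal n ℓ) → Clause n ℓ → Set
φ ∧ gs ⊢₁ C = ∃[ D ] (UR φ gs D × (D ≈C C))

_∧_⊢₁⊥ : ∀ {n ℓ} → CNF n ℓ → List (Literal n ℓ) → Set
φ ∧ gs ⊢₁⊥ = φ ∧ gs ⊢₁ []

countTrue : ∀ {n} → (Fin n → Bool) → ℕ
countTrue {zero} α = 0
countTrue {suc n} α = (if α Fin.zero then 1 else 0) + countTrue (λ i → α (Fin.suc i))

AMO : ∀ n → (Fin n → Bool) → Bool
AMO n α = countTrue α ≤ᵇ 1

EO : ∀ n → (Fin n → Bool) → Bool
EO n α = countTrue α ≡ᵇ 1

IsEncoding : ∀ {n ℓ} → CNF n ℓ → ((Fin n → Bool) → Bool) → Set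
IsEncoding {n} {ℓ} φ f =
  ∀ (α : Fin n → Bool) → (f α ≡ true) ⇔ (∃[ β ] Sat φ α β)

IsPCEncoding : ∀ {n ℓ} → CNF n ℓ → ((Fin n → Bool) → Bool) → Set
IsPCEncoding {n} {ℓ} φ f =
  IsEncoding φ f ×
  (∀ (g : Literal n ℓ) (gs : List (Literal n ℓ)) (h : Literal n ℓ) →
     All IsInputLit (g ∷ gs) → IsInputLit h →
     (∀ (α : Fin n → Bool) (β : Fin ℓ → Bool) → f α ≡ true →
        All (λ l → evalLit α β l ≡ true) (g ∷ gs) → evalLit α β h ≡ true) →
     (φ ∧ (g ∷ gs) ⊢₁ (h ∷ [])) ⊎ (φ ∧ (g ∷ gs) ⊢₁⊥))

IsPEncoding : ∀ {n ℓ} → CNF n ℓ → Set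
IsPEncoding {n} {ℓ} φ =
  (∀ (i : Fin n) → ∃[ α ] ∃[ β ] (Sat φ α β × α i ≡ true)) ×
  (∀ (i j : Fin n) → i ≢ j → φ ∧ (pos-x i ∷ []) ⊢₁ (neg-x j ∷ []))

module Submission where

-- Both AMO_n and EO_n accept every unit vector e_i (x_i = 1, all other
-- inputs 0) and reject every input with two ones.  Every PC encoding φ
-- of a function f with these two properties is a P-encoding:
--   (P1) f(e_i) = 1, so by the encoding property φ ∧ x_i is satisfied by
--        (e_i, β) for a suitable β;
--   (P2) for i ≠ j the function f entails x_i → ¬x_j, so propagation
--        completeness gives φ ∧ x_i ⊢₁ ¬x_j or φ ∧ x_i ⊢₁ ⊥; the second
--        alternative is impossible because unit resolution is sound and
--        φ ∧ x_i is satisfiable by (P1).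

open import Defs
open import Data.Nat using (ℕ; zero; suc; _≤_; s≤s; z≤n)
open import Data.Nat.Properties using (≤ᵇ⇒≤; ≡ᵇ⇒≡; ≤-reflexive; ≤-trans; m≤n+m)
open import Data.Bool using (Bool; true; false; not; T)
open import Data.Bool.Properties using (not-involutive)
open import Data.Sum using (_⊎_; inj₁; inj₂)
open import Data.Product using (_×_; _,_; ∃-syntax)
open import Data.Fin using (Fin)
open import Data.List using (List; []; _∷_)
open import Data.List.Relation.Unary.All using (All; []; _∷_; lookup)
open import Data.List.Relation.Unary.Any using (here; there)
open import Data.List.Relation.Unary.Any.Properties using (¬Any[])
open import Data.List.Relation.Binary.Subset.Propositional.Properties using (Any-resp-⊆)
open import Relation.Nullary using (¬_; yes; no; contradiction)
open import Relation.Binary.PropositionalEquality using (_≡_; _≢_; refl; sym; cong; subst)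
open import Function.Bundles using (Equivalence)

unitVector : ∀ {n} → Fin n → Fin n → Bool
unitVector Fin.zero    Fin.zero    = true
unitVector Fin.zero    (Fin.suc _) = false
unitVector (Fin.suc _) Fin.zero    = false
unitVector (Fin.suc i) (Fin.suc k) = unitVector i k

unitVector-self : ∀ {n} (i : Fin n) → unitVector i i ≡ true
unitVector-self Fin.zero    = refl
unitVector-self (Fin.suc i) = unitVector-self i

countTrue-allFalse : ∀ n → countTrue {n} (λ _ → false) ≡ 0
countTrue-allFalse zero    = refl
countTrue-allFalse (suc n) = countTrue-allFalse n

countTrue-unitVector : ∀ {n} (i : Fin n) → countTrue (unitVector i) ≡ 1
countTrue-unitVector {suc n} Fin.zero = cong suc (countTrue-allFalse n)
countTrue-unitVector (Fin.suc i)      = countTrue-unitVector i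

true⇒1≤countTrue : ∀ {n} (α : Fin n → Bool) (i : Fin n) →
                   α i ≡ true → 1 ≤ countTrue α
true⇒1≤countTrue α Fin.zero αi rewrite αi = s≤s z≤n
true⇒1≤countTrue α (Fin.suc i) αi =
  ≤-trans (true⇒1≤countTrue (λ k → α (Fin.suc k)) i αi) (m≤n+m _ _)

twoTrue⇒2≤countTrue : ∀ {n} (α : Fin n → Bool) (i j : Fin n) → i ≢ j →
                      α i ≡ true → α j ≡ true → 2 ≤ countTrue α
twoTrue⇒2≤countTrue α Fin.zero Fin.zero i≢j _ _ = contradiction refl i≢j
twoTrue⇒2≤countTrue α Fin.zero (Fin.suc j) _ αi αj rewrite αi =
  s≤s (true⇒1≤countTrue (λ k → α (Fin.suc k)) j αj)
twoTrue⇒2≤countTrue α (Fin.suc i) Fin.zero _ αi αj rewrite αj =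
  s≤s (true⇒1≤countTrue (λ k → α (Fin.suc k)) i αi)
twoTrue⇒2≤countTrue α (Fin.suc i) (Fin.suc j) i≢j αi αj =
  ≤-trans (twoTrue⇒2≤countTrue (λ k → α (Fin.suc k)) i j
             (λ i≡j → i≢j (cong Fin.suc i≡j)) αi αj)
          (m≤n+m _ _)

evalLit-neg : ∀ {n ℓ} (α : Fin n → Bool) (β : Fin ℓ → Bool) (l : Literal n ℓ) →
              evalLit α β (neg l) ≡ not (evalLit α β l)
evalLit-neg α β (inj₁ i , true)  = refl
evalLit-neg α β (inj₁ i , false) = sym (not-involutive (α i))
evalLit-neg α β (inj₂ j , true)  = refl
evalLit-neg α β (inj₂ j , false) = sym (not-involutive (β j))

neg-of-true-is-false : ∀ {n ℓ} (α : Fin n → Bool) (β : Fin ℓ → Bool) (l : Literal n ℓ) →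
                       evalLit α β l ≡ true → evalLit α β (neg l) ≢ true
neg-of-true-is-false α β l l-true rewrite evalLit-neg α β l | l-true = λ ()

SatClause-remove : ∀ {n ℓ} (α : Fin n → Bool) (β : Fin ℓ → Bool)
                   (l : Literal n ℓ) (C : Clause n ℓ) →
                   evalLit α β l ≡ true → SatClause α β C →
                   SatClause α β (remove (neg l) C)
SatClause-remove α β l (c ∷ C) l-true sat with c ≟L neg l | sat
... | yes refl | here c-true =
  contradiction c-true (neg-of-true-is-false α β l l-true)
... | yes _    | there sat′ = SatClause-remove α β l C l-true sat′
... | no _     | here c-true = here c-true
... | no _     | there sat′ = there (SatClause-remove α β l C l-true sat′)

UR-sound : ∀ {n ℓ} {φ : CNF n ℓ} {gs : List (Literal n ℓ)} {C : Clause n ℓ}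
           (α : Fin n → Bool) (β : Fin ℓ → Bool) →
           Sat φ α β → All (λ g → evalLit α β g ≡ true) gs →
           UR φ gs C → SatClause α β C
UR-sound α β sat gs-true (UR.axiom C∈φ) = lookup sat C∈φ
UR-sound α β sat gs-true (UR.unit g∈gs) = here (lookup gs-true g∈gs)
UR-sound α β sat gs-true (UR.resolve {l} {C} unitL derC _)
  with UR-sound α β sat gs-true unitL
... | here l-true = SatClause-remove α β l C l-true (UR-sound α β sat gs-true derC)

satisfiable⇒¬⊢₁⊥ : ∀ {n ℓ} {φ : CNF n ℓ} {gs : List (Literal n ℓ)}
                   (α : Fin n → Bool) (β : Fin ℓ → Bool) →
                   Sat φ α β → All (λ g → evalLit α β g ≡ true) gs →
                   ¬ (φ ∧ gs ⊢₁⊥)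
satisfiable⇒¬⊢₁⊥ α β sat gs-true (D , derD , D⊆[] , _) =
  ¬Any[] (Any-resp-⊆ D⊆[] (UR-sound α β sat gs-true derD))

AcceptsUnitVectors : ∀ {n} → ((Fin n → Bool) → Bool) → Set
AcceptsUnitVectors {n} f = ∀ (i : Fin n) → f (unitVector i) ≡ true

AtMostOneOne : ∀ {n} → ((Fin n → Bool) → Bool) → Set
AtMostOneOne f = ∀ α → f α ≡ true → countTrue α ≤ 1

PC⇒P : ∀ {n ℓ} (φ : CNF n ℓ) (f : (Fin n → Bool) → Bool) →
       AcceptsUnitVectors f → AtMostOneOne f →
       IsPCEncoding φ f → IsPEncoding φ
PC⇒P {n} {ℓ} φ f acceptsUnit atMostOne (encodes , complete) = P1 , P2
  where
  P1 : ∀ (i : Fin n) → ∃[ α ] ∃[ β ] (Sat φ α β × α i ≡ true)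
  P1 i with Equivalence.to (encodes (unitVector i)) (acceptsUnit i)
  ... | β , sat = unitVector i , β , sat , unitVector-self i

  xi⊨¬xj : ∀ {i j} → i ≢ j → ∀ (α : Fin n → Bool) (β : Fin ℓ → Bool) →
           f α ≡ true → All (λ l → evalLit α β l ≡ true) (pos-x i ∷ []) →
           evalLit α β (neg-x j) ≡ true
  xi⊨¬xj {i} {j} i≢j α β fα (αi ∷ []) with α j in αj
  ... | false = refl
  ... | true with ≤-trans (twoTrue⇒2≤countTrue α i j i≢j αi αj) (atMostOne α fα)
  ...   | s≤s ()

  P2 : ∀ (i j : Fin n) → i ≢ j → φ ∧ (pos-x i ∷ []) ⊢₁ (neg-x j ∷ [])
  P2 i j i≢j with complete (pos-x i) [] (neg-x j) ((i , refl) ∷ []) (j , refl) (xi⊨¬xj i≢j)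
  ... | inj₁ derives = derives
  ... | inj₂ refutes with P1 i
  ...   | α , β , sat , αi = contradiction refutes (satisfiable⇒¬⊢₁⊥ α β sat (αi ∷ []))

AMO-acceptsUnitVectors : ∀ n → AcceptsUnitVectors (AMO n)
AMO-acceptsUnitVectors n i rewrite countTrue-unitVector i = refl

AMO-atMostOneOne : ∀ n → AtMostOneOne (AMO n)
AMO-atMostOneOne n α accepted = ≤ᵇ⇒≤ (countTrue α) 1 (subst T (sym accepted) _)

EO-acceptsUnitVectors : ∀ n → AcceptsUnitVectors (EO n)
EO-acceptsUnitVectors n i rewrite countTrue-unitVector i = refl

EO-atMostOneOne : ∀ n → AtMostOneOne (EO n)
EO-atMostOneOne n α accepted = ≤-reflexive (≡ᵇ⇒≡ (countTrue α) 1 (subst T (sym accepted) _))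

lemma1 : ∀ (n ℓ : ℕ) (φ : CNF n ℓ) → WellFormedCNF φ →
         IsPCEncoding φ (AMO n) ⊎ IsPCEncoding φ (EO n) →
         IsPEncoding φ
lemma1 n ℓ φ _ (inj₁ pcAMO) =
  PC⇒P φ (AMO n) (AMO-acceptsUnitVectors n) (AMO-atMostOneOne n) pcAMO
lemma1 n ℓ φ _ (inj₂ pcEO) =
  PC⇒P φ (EO n) (EO-acceptsUnitVectors n) (EO-atMostOneOne n) pcEO
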